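{- Let $u,v \in V$ be two vertices, $A \subseteq E$ a set of edges, and $b_u \in \mathcal{B} \cap \mathrm{ball}_{G-A}(u,\lambda)$ and $b_v \in \mathcal{B} \cap \mathrm{ball}_{G-A}(v,\lambda)$. Let $\ell$ be a positive integer and $P$ the shortest $\ell$-expath with granularity $\lambda$ between $b_u$ and $b_v$ in $G-A$. Then, for every vertex $y \in V(P)$ with $|P[b_u..y]| > \lambda$ and $|P[y..b_v]| > \lambda$, it holds that $|P[b_u..y]| \le 4 \cdot d^{(\ell)}(u,y,A) + \lambda$ and $|P[y..b_v]| \le 4 \cdot d^{(\ell)}(y,v,A) + \lambda$.
   Context: $G=(V,E)$ is an undirected, unweighted graph on $n$ vertices with unique shortest paths; $\lambda \ge 0$ is an integer; $\mathcal{B} \subseteq V$ is a set of vertices. For $A \subseteq E$, $G-A$ is $G$ with the edges of $A$ removed, $d_{G-A}$ its distance (number of edges), and $\mathrm{ball}_{G-A}(x,\lambda) = \{z \in V : d_{G-A}(x,z) \le \lambda\}$. For a path $P$ and vertices $x,y$ on it, $P[x..y]$ is the subpath from $x$ to $y$ and $|P|$ is the number of edges. An $\ell$-decomposable path in $G-A$ is a path in $G-A$ that is the concatenation of at most $\ell+1$ shortest paths of $G$. $d^{(\ell)}(x,y,A)$ is the minimum length of an $\ell$-decomposable $x$-$y$-path in $G-A$ ($+\infty$ if none). An $\ell$-expath with granularity $\lambda$ in $G-A$ is a path $P_a \circ P_b \circ P_c$ in $G-A$ such that $P_a$ and $P_c$ have at most $\lambda$ edges each and $P_b$ is a concatenation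 of $2\log_2(n)+1$ (possibly empty) $\ell$-decomposable paths such that, for every $0 \le i \le 2\log_2 n$, the $i$-th of them has length at most $\min(2^i, 2^{2\log_2(n)-i})$. The shortest such path between $b_u$ and $b_v$ is the one of minimum length. -}

module Defs where

open import Data.Nat using (ℕ; zero; suc; _+_; _*_; _∸_; _^_; _≤_; _<_; _⊓_)
open import Data.Nat.Logarithm using (⌈log₂_⌉)
open import Data.Fin using (Fin; toℕ)
open import Data.List using (List; []; _∷_; _++_; [_])
import Data.List as List
open import Data.List.NonEmpty using (List⁺; _∷_; head; last; toList; _⁺++_)
open import Data.List.Relation.Unary.Linked using (Linked)
open import Data.List.Relation.Unary.Unique.Propositional using (Unique)
open import Data.Vec.Functional using (Vector)
import Data.Vec.Functional as VF
open import Data.Product using (Σ; _×_; ∃; ∃-syntax; _,_)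
open import Data.Unit using (⊤)
open import Data.List.Relation.Unary.All using (All)
open import Relation.Nullary using (¬_)
open import Relation.Binary.PropositionalEquality using (_≡_; _≢_)

record Graph (n : ℕ) : Set₁ where
  field
    Adj     : Fin n → Fin n → Set
    sym     : ∀ {x y} → Adj x y → Adj y x
    irrefl  : ∀ {x} → ¬ Adj x x

Path : ℕ → Set
Path n = List⁺ (Fin n)

∣_∣ₚ : ∀ {n} → Path n → ℕ
∣ p ∣ₚ = List.length (List⁺.tail p)

IsWalk : ∀ {n} → (Fin n → Fin n → Set) → Path n → Set
IsWalk R p = Linked R (toList p)

IsPath : ∀ {n} → (Fin n → Fin n → Set) → Path n → Set
IsPath R p = IsWalk R p × Unique (toList p)

-- concatenation P ∘ Q of paths (last P = head Q, shared vertex kept once)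
_∘ₚ_ : ∀ {n} → Path n → Path n → Path n
p ∘ₚ q = p ⁺++ List⁺.tail q

concatP : ∀ {n} → Path n → List (Path n) → Path n
concatP s []       = s
concatP s (t ∷ ts) = s ∘ₚ concatP t ts

Chained : ∀ {n} → Path n → List (Path n) → Set
Chained s []       = ⊤
Chained s (t ∷ ts) = (last s ≡ head t) × Chained t ts

-- A ⊆ E given as a predicate on ordered pairs; the edge {x,y} is removed
-- iff A x y or A y x.
EdgeSet : ℕ → Set₁
EdgeSet n = Fin n → Fin n → Set

_⊆E_ : ∀ {n} → EdgeSet n → Graph n → Set
A ⊆E G = ∀ {x y} → A x y → Graph.Adj G x y

AdjMinus : ∀ {n} → Graph n → EdgeSet n → Fin n → Fin n → Set
AdjMinus G A x y = Graph.Adj G x y × ¬ A x y × ¬ A y x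

IsShortest : ∀ {n} → Graph n → Path n → Set
IsShortest G p =
  IsPath (Graph.Adj G) p ×
  (∀ q → IsWalk (Graph.Adj G) q → head q ≡ head p → last q ≡ last p → ∣ p ∣ₚ ≤ ∣ q ∣ₚ)

UniqueShortestPaths : ∀ {n} → Graph n → Set
UniqueShortestPaths G =
  ∀ p q → IsShortest G p → IsShortest G q →
  head p ≡ head q → last p ≡ last q → p ≡ q

IsDecomposable : ∀ {n} → Graph n → EdgeSet n → ℕ → Path n → Set
IsDecomposable {n} G A ℓ p =
  IsPath (AdjMinus G A) p ×
  Σ (Path n) λ s → Σ (List (Path n)) λ ts →
    (suc (List.length ts) ≤ suc ℓ) ×
    IsShortest G s × All (IsShortest G) ts ×
    Chained s ts × (p ≡ concatP s ts)

-- log₂ n, rounded up (the paper writes log₂ n)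
logn : ℕ → ℕ
logn n = ⌈log₂ n ⌉

IsExpath : ∀ {n} → Graph n → EdgeSet n → ℕ → ℕ → Path n → Set
IsExpath {n} G A ℓ Λ p =
  IsPath (AdjMinus G A) p ×
  Σ (Path n) λ pa → Σ (Vector (Path n) (suc (2 * logn n))) λ bs → Σ (Path n) λ pc →
    (∣ pa ∣ₚ ≤ Λ) × (∣ pc ∣ₚ ≤ Λ) ×
    (∀ (i : Fin (suc (2 * logn n))) →
        IsDecomposable G A ℓ (bs i) ×
        (∣ bs i ∣ₚ ≤ (2 ^ toℕ i) ⊓ (2 ^ (2 * logn n ∸ toℕ i)))) ×
    Chained pa (VF.toList bs ++ [ pc ]) ×
    (p ≡ concatP pa (VF.toList bs ++ [ pc ]))

IsShortestExpath : ∀ {n} → Graph n → EdgeSet n → ℕ → ℕ → Fin n → Fin n → Path n → Set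
IsShortestExpath G A ℓ Λ b b' p =
  IsExpath G A ℓ Λ p × head p ≡ b × last p ≡ b' ×
  (∀ q → IsExpath G A ℓ Λ q → head q ≡ b → last q ≡ b' → ∣ p ∣ₚ ≤ ∣ q ∣ₚ)

InBall : ∀ {n} → Graph n → EdgeSet n → Fin n → ℕ → Fin n → Set
InBall G A x Λ z =
  ∃[ w ] IsWalk (AdjMinus G A) w × head w ≡ x × last w ≡ z × ∣ w ∣ₚ ≤ Λ

-- Let y = P[i] lie in the j-th block of Pb. The blocks before it have lengths at most
-- 1, 2, ..., 2^(j-1), so |P[bu..y]| + 2 ≤ λ + 2^(j+1), and the claim holds unless d = |Q| ≤ 2^(j-1)
-- for the given ℓ-decomposable u-y path Q. Then Q can serve as block k = min (j - 1) (log n):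
-- a path from bu to u inside the ball, followed by Q and P[y..bv], with trivial blocks in
-- between, is a walk made of admissible slots. Shortcutting its repeated vertices slot by slot
-- yields an ℓ-expath from bu to bv that is no longer, so minimality of P gives
-- |P[bu..y]| ≤ λ + d. The bound on P[y..bv] is the mirror image, with Q as block 2 log n - k.

module Submission where

open import Defs
open import Data.Nat using (ℕ; zero; suc; _+_; _*_; _∸_; _^_; _≤_; _<_; _⊓_; z≤n; s≤s; _≤?_; _<?_; ⌈_/2⌉)
open import Data.Nat.Properties
open import Data.Fin using (Fin; toℕ) renaming (zero to fzero; suc to fsuc; _≟_ to _≟ᶠ_)
open import Data.List using (List; []; _∷_; _++_; length; lookup; take; replicate; map; initLast; _∷ʳ′_)
open import Data.Nat.ListAction using (sum)
open import Data.Nat.ListAction.Properties using (sum-++)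
import Data.List.Properties as List
open import Data.List.NonEmpty using (List⁺; _∷_; head; tail; last; toList; snocView)
import Data.List.NonEmpty as List⁺
open import Data.List.Relation.Unary.Linked using (Linked; []; [-]; _∷_)
open import Data.List.Relation.Unary.All using (All; []; _∷_)
import Data.List.Relation.Unary.Unique.Propositional.Properties as Unique
import Data.List.Relation.Unary.All as All
import Data.List.Membership.DecPropositional as DecMembership
open import Data.List.Membership.Propositional.Properties using (∈-++⁻; ∈-++⁺ʳ; ∈-lookup)
open import Data.Fin.Properties using (pigeonhole; toℕ<n) renaming (<⇒≢ to <⇒≢ᶠ)
open import Data.Nat.Logarithm using (⌈log₂_⌉)
open import Data.Nat.Logarithm.Core using (⌈log2⌉)
open import Data.Nat.Induction using (<-wellFounded)
open import Induction.WellFounded using (Acc; acc)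
open import Data.Sum using (inj₁; inj₂)
open import Data.Empty using (⊥-elim)
open import Data.List.Relation.Unary.Any using (here; there)
open import Data.List.Membership.Propositional using (_∈_)
open import Data.Product using (Σ; _×_; ∃-syntax; ∃₂; _,_; proj₁; proj₂)
open import Data.List.Relation.Unary.Unique.Propositional using (Unique; []; _∷_)
import Data.Vec.Functional as VF
open import Data.Nat.Tactic.RingSolver using (solve-∀)
open import Data.Unit using (⊤)
open import Relation.Nullary using (yes; no)
open import Relation.Binary.PropositionalEquality

lastFrom : ∀ {A : Set} → A → List A → A
lastFrom x []       = x
lastFrom _ (y ∷ ys) = lastFrom y ys

lastFrom-++ : ∀ {A : Set} (x : A) xs ys → lastFrom x (xs ++ ys) ≡ lastFrom (lastFrom x xs) ys
lastFrom-++ x []       ys = refl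
lastFrom-++ _ (y ∷ xs) ys = lastFrom-++ y xs ys

last-∷ : ∀ {A : Set} (xs : List⁺ A) → last xs ≡ lastFrom (head xs) (tail xs)
last-∷ xs with snocView xs
... | []       List⁺.∷ʳ′ y = refl
... | (z ∷ zs) List⁺.∷ʳ′ y = sym (lastFrom-++ z zs (y ∷ []))

last-∷∷ : ∀ {A : Set} (x y : A) ys → last (x ∷ y ∷ ys) ≡ last (y ∷ ys)
last-∷∷ x y ys = trans (last-∷ (x ∷ y ∷ ys)) (sym (last-∷ (y ∷ ys)))

module _ {n : ℕ} where

  single : Fin n → Path n
  single x = x ∷ []

  prefix : ℕ → Path n → Path n
  prefix k (x ∷ xs) = x ∷ take k xs

  suffix : ℕ → Path n → Path n
  suffix zero    p            = p
  suffix (suc k) (x ∷ [])     = x ∷ []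
  suffix (suc k) (_ ∷ y ∷ ys) = suffix k (y ∷ ys)

  ∣suffix∣ : ∀ k p → ∣ suffix k p ∣ₚ ≡ ∣ p ∣ₚ ∸ k
  ∣suffix∣ zero    p            = refl
  ∣suffix∣ (suc k) (x ∷ [])     = refl
  ∣suffix∣ (suc k) (_ ∷ y ∷ ys) = ∣suffix∣ k (y ∷ ys)

  ∣suffix∣≤ : ∀ k p → ∣ suffix k p ∣ₚ ≤ ∣ p ∣ₚ
  ∣suffix∣≤ k p = ≤-trans (≤-reflexive (∣suffix∣ k p)) (m∸n≤m ∣ p ∣ₚ k)

  ∣prefix∣≤ : ∀ k p → ∣ prefix k p ∣ₚ ≤ ∣ p ∣ₚ
  ∣prefix∣≤ k (x ∷ xs) = ≤-trans (≤-reflexive (List.length-take k xs)) (m⊓n≤n k (length xs))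

  ∣prefix∣ : ∀ k p → k ≤ ∣ p ∣ₚ → ∣ prefix k p ∣ₚ ≡ k
  ∣prefix∣ k (x ∷ xs) k≤ = trans (List.length-take k xs) (m≤n⇒m⊓n≡m k≤)

  last-suffix : ∀ k p → last (suffix k p) ≡ last p
  last-suffix zero    p            = refl
  last-suffix (suc k) (x ∷ [])     = refl
  last-suffix (suc k) (x ∷ y ∷ ys) = trans (last-suffix k (y ∷ ys)) (sym (last-∷∷ x y ys))

  last-prefix : ∀ k p → last (prefix k p) ≡ head (suffix k p)
  last-prefix k p = trans (last-∷ (prefix k p)) (go k p)
    where
    go : ∀ k p → lastFrom (head p) (take k (tail p)) ≡ head (suffix k p)
    go zero    p            = refl
    go (suc k) (x ∷ [])     = refl
    go (suc k) (x ∷ y ∷ ys) = go k (y ∷ ys)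

  head-suffix : ∀ p (i : Fin (length (toList p))) → head (suffix (toℕ i) p) ≡ lookup (toList p) i
  head-suffix p            fzero    = refl
  head-suffix (x ∷ y ∷ ys) (fsuc i) = head-suffix (y ∷ ys) i

  ∣∘ₚ∣ : ∀ (p q : Path n) → ∣ p ∘ₚ q ∣ₚ ≡ ∣ p ∣ₚ + ∣ q ∣ₚ
  ∣∘ₚ∣ p q = List.length-++ (tail p) {tail q}

  last-∘ₚ : ∀ (p q : Path n) → last p ≡ head q → last (p ∘ₚ q) ≡ last q
  last-∘ₚ p q e = begin
    last (p ∘ₚ q)                              ≡⟨ last-∷ (p ∘ₚ q) ⟩
    lastFrom (head p) (tail p ++ tail q)       ≡⟨ lastFrom-++ (head p) (tail p) (tail q) ⟩
    lastFrom (lastFrom (head p) (tail p)) (tail q)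
      ≡⟨ cong (λ z → lastFrom z (tail q)) (trans (sym (last-∷ p)) e) ⟩
    lastFrom (head q) (tail q)                 ≡⟨ sym (last-∷ q) ⟩
    last q                                     ∎
    where open ≡-Reasoning

  single-∘ₚ : ∀ x (q : Path n) → x ≡ head q → single x ∘ₚ q ≡ q
  single-∘ₚ x q refl = refl

  ∘ₚ-single : ∀ (p : Path n) x → p ∘ₚ single x ≡ p
  ∘ₚ-single (y ∷ ys) x = cong (y ∷_) (List.++-identityʳ ys)

  prefix-∘ₚ-suffix : ∀ k (p : Path n) → prefix k p ∘ₚ suffix k p ≡ p
  prefix-∘ₚ-suffix zero    (x ∷ xs)     = refl
  prefix-∘ₚ-suffix (suc k) (x ∷ [])     = refl
  prefix-∘ₚ-suffix (suc k) (x ∷ y ∷ ys) = cong (λ q → x ∷ toList q) (prefix-∘ₚ-suffix k (y ∷ ys))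

  ∣prefix∣+∣suffix∣ : ∀ k (p : Path n) → ∣ prefix k p ∣ₚ + ∣ suffix k p ∣ₚ ≡ ∣ p ∣ₚ
  ∣prefix∣+∣suffix∣ k p = trans (sym (∣∘ₚ∣ (prefix k p) (suffix k p))) (cong ∣_∣ₚ (prefix-∘ₚ-suffix k p))

  suffix-∘ₚ : ∀ k (p q : Path n) → last p ≡ head q → suffix (∣ p ∣ₚ + k) (p ∘ₚ q) ≡ suffix k q
  suffix-∘ₚ k (x ∷ xs) q = go x xs
    where
    go : ∀ x xs → last (x ∷ xs) ≡ head q → suffix (length xs + k) ((x ∷ xs) ∘ₚ q) ≡ suffix k q
    go x []       e = cong (suffix k) (single-∘ₚ x q e)
    go x (y ∷ ys) e = go y ys (trans (sym (last-∷∷ x y ys)) e)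

  suffix-∘ₚ-≤ : ∀ k (p q : Path n) → k ≤ ∣ p ∣ₚ → suffix k (p ∘ₚ q) ≡ suffix k p ∘ₚ q
  suffix-∘ₚ-≤ zero    p            q _       = refl
  suffix-∘ₚ-≤ (suc k) (x ∷ y ∷ ys) q (s≤s h) = suffix-∘ₚ-≤ k (y ∷ ys) q h

  prefix-∘ₚ-≤ : ∀ k (p q : Path n) → k ≤ ∣ p ∣ₚ → prefix k (p ∘ₚ q) ≡ prefix k p
  prefix-∘ₚ-≤ zero    p            q _       = refl
  prefix-∘ₚ-≤ (suc k) (x ∷ y ∷ ys) q (s≤s h) = cong (λ r → x ∷ toList r) (prefix-∘ₚ-≤ k (y ∷ ys) q h)

  prefix-∘ₚ : ∀ k (p q : Path n) → prefix (∣ p ∣ₚ + k) (p ∘ₚ q) ≡ p ∘ₚ prefix k q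
  prefix-∘ₚ k (x ∷ xs) q = cong (x ∷_) (go xs)
    where
    go : ∀ xs → take (length xs + k) (xs ++ tail q) ≡ xs ++ take k (tail q)
    go []       = refl
    go (y ∷ ys) = cong (y ∷_) (go ys)

  prefix-all : ∀ (p : Path n) → prefix ∣ p ∣ₚ p ≡ p
  prefix-all (x ∷ xs) = cong (x ∷_) (List.take-all (length xs) xs ≤-refl)

  ∈-suffix : ∀ k (p : Path n) {z} → z ∈ toList (suffix k p) → z ∈ toList p
  ∈-suffix zero    p            z∈ = z∈
  ∈-suffix (suc k) (x ∷ [])     z∈ = z∈
  ∈-suffix (suc k) (x ∷ y ∷ ys) z∈ = there (∈-suffix k (y ∷ ys) z∈)

  ∈-prefix : ∀ k (p : Path n) {z} → z ∈ toList (prefix k p) → z ∈ toList p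
  ∈-prefix k       (x ∷ xs)     (here e)        = here e
  ∈-prefix (suc k) (x ∷ y ∷ ys) (there z∈)      = there (∈-prefix k (y ∷ ys) z∈)

  ∈⇒suffix : ∀ (p : Path n) {z} → z ∈ toList p → ∃[ k ] k ≤ ∣ p ∣ₚ × head (suffix k p) ≡ z
  ∈⇒suffix p            (here e)   = 0 , z≤n , sym e
  ∈⇒suffix (x ∷ y ∷ ys) (there z∈) with ∈⇒suffix (y ∷ ys) z∈
  ... | k , k≤ , e = suc k , s≤s k≤ , e

  module _ {R : Fin n → Fin n → Set} where

    walk-suffix : ∀ k (p : Path n) → IsWalk R p → IsWalk R (suffix k p)
    walk-suffix zero    p            w       = w
    walk-suffix (suc k) (x ∷ [])     w       = w
    walk-suffix (suc k) (x ∷ y ∷ ys) (_ ∷ w) = walk-suffix k (y ∷ ys) w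

    walk-prefix : ∀ k (p : Path n) → IsWalk R p → IsWalk R (prefix k p)
    walk-prefix zero    (x ∷ xs)     w       = [-]
    walk-prefix (suc k) (x ∷ [])     w       = [-]
    walk-prefix (suc k) (x ∷ y ∷ ys) (r ∷ w) = r ∷ walk-prefix k (y ∷ ys) w

    walk-∘ₚ : ∀ (p q : Path n) → IsWalk R p → IsWalk R q → last p ≡ head q → IsWalk R (p ∘ₚ q)
    walk-∘ₚ (x ∷ [])     q _       wq refl = wq
    walk-∘ₚ (x ∷ y ∷ ys) q (r ∷ w) wq e    =
      r ∷ walk-∘ₚ (y ∷ ys) q w wq (trans (sym (last-∷∷ x y ys)) e)

    path-single : ∀ x → IsPath R (single x)
    path-single x = [-] , [] ∷ []

    path-suffix : ∀ k (p : Path n) → IsPath R p → IsPath R (suffix k p)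
    path-suffix k p (w , u) = walk-suffix k p w , unique-suffix k p u
      where
      unique-suffix : ∀ k (p : Path n) → Unique (toList p) → Unique (toList (suffix k p))
      unique-suffix zero    p            u       = u
      unique-suffix (suc k) (x ∷ [])     u       = u
      unique-suffix (suc k) (x ∷ y ∷ ys) (_ ∷ u) = unique-suffix k (y ∷ ys) u

    path-prefix : ∀ k (p : Path n) → IsPath R p → IsPath R (prefix k p)
    path-prefix k p (w , u) = walk-prefix k p w , Unique.take⁺ (suc k) u

module _ {n : ℕ} (G : Graph n) where

  shortest-single : ∀ x → IsShortest G (single x)
  shortest-single x = path-single x , λ _ _ _ _ → z≤n

  shortest-suffix : ∀ k p → IsShortest G p → IsShortest G (suffix k p)
  shortest-suffix k p (pp , minimal) = path-suffix k p pp , λ q wq hq lq →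
    +-cancelˡ-≤ ∣ prefix k p ∣ₚ _ _ (subst₂ _≤_
      (sym (∣prefix∣+∣suffix∣ k p)) (∣∘ₚ∣ (prefix k p) q)
      (minimal (prefix k p ∘ₚ q) (walk-∘ₚ (prefix k p) q (walk-prefix k p (proj₁ pp)) wq (joint q hq)) refl
        (trans (last-∘ₚ (prefix k p) q (joint q hq)) (trans lq (last-suffix k p)))))
    where
    joint : ∀ (q : Path n) → head q ≡ head (suffix k p) → last (prefix k p) ≡ head q
    joint _ hq = trans (last-prefix k p) (sym hq)

  shortest-prefix : ∀ k p → IsShortest G p → IsShortest G (prefix k p)
  shortest-prefix k p (pp , minimal) = path-prefix k p pp , λ q wq hq lq →
    +-cancelʳ-≤ ∣ suffix k p ∣ₚ _ _ (subst₂ _≤_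
      (sym (∣prefix∣+∣suffix∣ k p)) (∣∘ₚ∣ q (suffix k p))
      (minimal (q ∘ₚ suffix k p) (walk-∘ₚ q (suffix k p) wq (walk-suffix k p (proj₁ pp)) (joint q lq)) hq
        (trans (last-∘ₚ q (suffix k p) (joint q lq)) (last-suffix k p))))
    where
    joint : ∀ (q : Path n) → last q ≡ last (prefix k p) → last q ≡ head (suffix k p)
    joint _ lq = trans lq (last-prefix k p)

module _ {n : ℕ} where

  ∣_∣ₛ : List (Path n) → ℕ
  ∣ ts ∣ₛ = sum (map ∣_∣ₚ ts)

  ∣++∣ₛ : ∀ xs ys → ∣ xs ++ ys ∣ₛ ≡ ∣ xs ∣ₛ + ∣ ys ∣ₛ
  ∣++∣ₛ xs ys = trans (cong sum (List.map-++ ∣_∣ₚ xs ys)) (sum-++ (map ∣_∣ₚ xs) (map ∣_∣ₚ ys))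

  ∘ₚ-assoc : ∀ (p q r : Path n) → (p ∘ₚ q) ∘ₚ r ≡ p ∘ₚ (q ∘ₚ r)
  ∘ₚ-assoc p q r = cong (head p ∷_) (List.++-assoc (tail p) (tail q) (tail r))

  head-concatP : ∀ s ts → head (concatP {n} s ts) ≡ head s
  head-concatP s []      = refl
  head-concatP s (_ ∷ _) = refl

  ∣concatP∣ : ∀ s ts → ∣ concatP {n} s ts ∣ₚ ≡ ∣ s ∣ₚ + ∣ ts ∣ₛ
  ∣concatP∣ s []       = sym (+-identityʳ ∣ s ∣ₚ)
  ∣concatP∣ s (t ∷ ts) = trans (∣∘ₚ∣ s (concatP t ts)) (cong (∣ s ∣ₚ +_) (∣concatP∣ t ts))

  concatP-++ : ∀ s xs t ts → concatP {n} s (xs ++ t ∷ ts) ≡ concatP s xs ∘ₚ concatP t ts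
  concatP-++ s []       t ts = refl
  concatP-++ s (x ∷ xs) t ts = trans (cong (s ∘ₚ_) (concatP-++ x xs t ts))
                                     (sym (∘ₚ-assoc s (concatP x xs) (concatP t ts)))

  concatP-single : ∀ s x ts → concatP {n} s (single x ∷ ts) ≡ concatP s ts
  concatP-single s x []      = ∘ₚ-single s x
  concatP-single s x (_ ∷ _) = refl

  concatP-singles : ∀ s c x ts → concatP {n} s (replicate c (single x) ++ ts) ≡ concatP s ts
  concatP-singles s zero    x ts = refl
  concatP-singles s (suc c) x ts =
    trans (concatP-single s x (replicate c (single x) ++ ts)) (concatP-singles s c x ts)

  concatP-replicate : ∀ s c x → concatP {n} s (replicate c (single x)) ≡ s
  concatP-replicate s zero    x = refl
  concatP-replicate s (suc c) x = trans (concatP-single s x (replicate c (single x))) (concatP-replicate s c x)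

  suffix-concatP : ∀ o s ts → o ≤ ∣ s ∣ₚ → suffix o (concatP {n} s ts) ≡ concatP (suffix o s) ts
  suffix-concatP o s []      _  = refl
  suffix-concatP o s (t ∷ ts) o≤ = suffix-∘ₚ-≤ o s (concatP t ts) o≤

  prefix-concatP : ∀ o s ts → o ≤ ∣ s ∣ₚ → prefix o (concatP {n} s ts) ≡ prefix o s
  prefix-concatP o s []      _  = refl
  prefix-concatP o s (t ∷ ts) o≤ = prefix-∘ₚ-≤ o s (concatP t ts) o≤

  length-singles : ∀ c x (ts : List (Path n)) → length (replicate c (single x) ++ ts) ≡ c + length ts
  length-singles zero    x ts = refl
  length-singles (suc c) x ts = cong suc (length-singles c x ts)

  lastSlot : Path n → List (Path n) → Path n
  lastSlot s []       = s
  lastSlot _ (t ∷ ts) = lastSlot t ts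

  last-concatP : ∀ s ts → Chained s ts → last (concatP s ts) ≡ last (lastSlot s ts)
  last-concatP s []       _        = refl
  last-concatP s (t ∷ ts) (e , ch) =
    trans (last-∘ₚ s (concatP t ts) (trans e (sym (head-concatP t ts)))) (last-concatP t ts ch)

  Chained-++⁻ : ∀ s xs t ts → Chained s (xs ++ t ∷ ts) →
                Chained s xs × last (lastSlot s xs) ≡ head t × Chained t ts
  Chained-++⁻ s []       t ts (e , ch) = _ , e , ch
  Chained-++⁻ s (x ∷ xs) t ts (e , ch) with Chained-++⁻ x xs t ts ch
  ... | chxs , e′ , chts = (e , chxs) , e′ , chts

  Chained-++⁺ : ∀ s xs t ts → Chained s xs → last (lastSlot s xs) ≡ head t → Chained t ts →
                Chained s (xs ++ t ∷ ts)
  Chained-++⁺ s []       t ts _          e chts = e , chts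
  Chained-++⁺ s (x ∷ xs) t ts (e′ , chxs) e chts = e′ , Chained-++⁺ x xs t ts chxs e chts

  Chained-singles : ∀ (s : Path n) c x (t : Path n) ts → last s ≡ x → x ≡ head t → Chained t ts →
                    Chained s (replicate c (single x) ++ t ∷ ts)
  Chained-singles s zero    x t ts e e′ ch = trans e e′ , ch
  Chained-singles s (suc c) x t ts e e′ ch = e , Chained-singles (single x) c x t ts refl e′ ch

  Chained-replicate : ∀ (s : Path n) c x → last s ≡ x → Chained s (replicate c (single x))
  Chained-replicate s zero    x e = _
  Chained-replicate s (suc c) x e = e , Chained-replicate (single x) c x refl

  Chained-cong-last : ∀ {s s′ : Path n} ts → last s′ ≡ last s → Chained s ts → Chained s′ ts
  Chained-cong-last []      _ _        = _
  Chained-cong-last (_ ∷ _) e (e′ , ch) = trans e e′ , ch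

AllFrom : ∀ {A : Set} → (ℕ → A → Set) → ℕ → List A → Set
AllFrom F m []       = ⊤
AllFrom F m (x ∷ xs) = F m x × AllFrom F (suc m) xs

module _ {A : Set} {F : ℕ → A → Set} where

  AllFrom-++⁻ : ∀ m xs ys → AllFrom F m (xs ++ ys) → AllFrom F m xs × AllFrom F (m + length xs) ys
  AllFrom-++⁻ m []       ys all = _ , subst (λ k → AllFrom F k ys) (sym (+-identityʳ m)) all
  AllFrom-++⁻ m (x ∷ xs) ys (fx , all) with AllFrom-++⁻ (suc m) xs ys all
  ... | allxs , allys = (fx , allxs) , subst (λ k → AllFrom F k ys) (sym (+-suc m (length xs))) allys

  AllFrom-++⁺ : ∀ m xs ys → AllFrom F m xs → AllFrom F (m + length xs) ys → AllFrom F m (xs ++ ys)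
  AllFrom-++⁺ m []       ys _            allys = subst (λ k → AllFrom F k ys) (+-identityʳ m) allys
  AllFrom-++⁺ m (x ∷ xs) ys (fx , allxs) allys =
    fx , AllFrom-++⁺ (suc m) xs ys allxs (subst (λ k → AllFrom F k ys) (+-suc m (length xs)) allys)

  AllFrom-replicate : ∀ {x} → (∀ m → F m x) → ∀ m c → AllFrom F m (replicate c x)
  AllFrom-replicate fx m zero    = _
  AllFrom-replicate fx m (suc c) = fx m , AllFrom-replicate fx (suc m) c

  AllFrom-replicate-++ : ∀ {x} → (∀ m → F m x) → ∀ m c ys → AllFrom F (m + c) ys →
                         AllFrom F m (replicate c x ++ ys)
  AllFrom-replicate-++ fx m zero    ys all = subst (λ k → AllFrom F k ys) (+-identityʳ m) all
  AllFrom-replicate-++ fx m (suc c) ys all =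
    fx m , AllFrom-replicate-++ fx (suc m) c ys (subst (λ k → AllFrom F k ys) (+-suc m c) all)

  AllFrom-tabulate⁺ : ∀ {N} m (f : Fin N → A) → (∀ i → F (m + toℕ i) (f i)) → AllFrom F m (VF.toList f)
  AllFrom-tabulate⁺ {zero}  m f all = _
  AllFrom-tabulate⁺ {suc N} m f all =
    subst (λ k → F k (f fzero)) (+-identityʳ m) (all fzero) ,
    AllFrom-tabulate⁺ (suc m) (λ i → f (fsuc i))
      (λ i → subst (λ k → F k (f (fsuc i))) (+-suc m (toℕ i)) (all (fsuc i)))

  AllFrom-lookup : ∀ m xs → AllFrom F m xs → ∀ i → F (m + toℕ i) (lookup xs i)
  AllFrom-lookup m (x ∷ xs) (fx , _)   fzero    = subst (λ k → F k x) (sym (+-identityʳ m)) fx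
  AllFrom-lookup m (x ∷ xs) (_ , all) (fsuc i) =
    subst (λ k → F k (lookup xs i)) (sym (+-suc m (toℕ i))) (AllFrom-lookup (suc m) xs all i)

  AllFrom-vector : ∀ {N} m xs → length xs ≡ N → AllFrom F m xs →
                   Σ (Fin N → A) λ f → VF.toList f ≡ xs × (∀ i → F (m + toℕ i) (f i))
  AllFrom-vector m xs refl all = lookup xs , List.tabulate-lookup xs , AllFrom-lookup m xs all

  AllFrom-map : ∀ {H : ℕ → A → Set} {m xs} → (∀ {k x} → F k x → H k x) → AllFrom F m xs → AllFrom H m xs
  AllFrom-map {xs = []}     f _          = _
  AllFrom-map {xs = x ∷ xs} f (fx , all) = f fx , AllFrom-map f all

module _ {A : Set} {P : A → Set} where

  All⇒AllFrom : ∀ {m xs} → All P xs → AllFrom (λ _ → P) m xs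
  All⇒AllFrom []         = _
  All⇒AllFrom (px ∷ pxs) = px , All⇒AllFrom pxs

  AllFrom⇒All : ∀ {m} xs → AllFrom (λ _ → P) m xs → All P xs
  AllFrom⇒All []       _           = []
  AllFrom⇒All (x ∷ xs) (px , pxs)  = px ∷ AllFrom⇒All xs pxs

module _ {n : ℕ} {R : Fin n → Fin n → Set} where
  open DecMembership (_≟ᶠ_ {n}) using (_∈?_)

  shortcut : ∀ (s c : Path n) → IsPath R s → IsPath R c → last s ∈ toList c →
             ∃₂ λ p k → IsPath R (prefix p s ∘ₚ suffix k c) × last (prefix p s) ≡ head (suffix k c)
  shortcut (x ∷ xs) c ps pc l∈ = go x xs ps (subst (_∈ toList c) (last-∷ (x ∷ xs)) l∈)
    where
    go : ∀ x xs → IsPath R (x ∷ xs) → lastFrom x xs ∈ toList c →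
         ∃₂ λ p k → IsPath R (prefix p (x ∷ xs) ∘ₚ suffix k c) × last (prefix p (x ∷ xs)) ≡ head (suffix k c)
    go x xs ps l∈ with x ∈? toList c
    ... | yes x∈ with ∈⇒suffix c x∈
    ...   | k , _ , e = 0 , k , subst (IsPath R) (sym (single-∘ₚ x (suffix k c) (sym e))) (path-suffix k c pc) , sym e
    go x []       ps                 l∈ | no x∉ = ⊥-elim (x∉ l∈)
    go x (y ∷ ys) (r ∷ w , x∉ys ∷ u) l∈ | no x∉ with go y ys (w , u) l∈
    ... | p , k , (w′ , u′) , e = suc p , k , (r ∷ w′ , All.tabulate fresh ∷ u′) , trans (last-∷∷ x y (take p ys)) e
      where
      fresh : ∀ {z} → z ∈ toList (prefix p (y ∷ ys) ∘ₚ suffix k c) → x ≢ z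
      fresh z∈ with ∈-++⁻ (y ∷ take p ys) z∈
      ... | inj₁ z∈ys = All.lookup x∉ys (∈-prefix p (y ∷ ys) z∈ys)
      ... | inj₂ z∈c  = λ { refl → x∉ (∈-suffix k c (there z∈c)) }

module _ {n : ℕ} {R : Fin n → Fin n → Set} where

  slot-paths : ∀ s ts → Chained s ts → IsPath R (concatP s ts) → IsPath R s × All (IsPath R) ts
  slot-paths s []       _        p = p , []
  slot-paths s (t ∷ ts) (e , ch) p with slot-paths t ts ch (subst (IsPath R) C-eq (path-suffix (∣ s ∣ₚ + 0) _ p))
    where
    C-eq : suffix (∣ s ∣ₚ + 0) (s ∘ₚ concatP t ts) ≡ concatP t ts
    C-eq = suffix-∘ₚ 0 s (concatP t ts) (trans e (sym (head-concatP t ts)))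
  ... | pt , pts = subst (IsPath R) s-eq (path-prefix ∣ s ∣ₚ _ p) , pt ∷ pts
    where
    s-eq : prefix ∣ s ∣ₚ (s ∘ₚ concatP t ts) ≡ s
    s-eq = trans (prefix-∘ₚ-≤ ∣ s ∣ₚ s (concatP t ts) ≤-refl) (prefix-all s)

module Slotted {n : ℕ} (F : ℕ → Path n → Set)
               (F-prefix : ∀ {m} k p → F m p → F m (prefix k p))
               (F-suffix : ∀ {m} k p → F m p → F m (suffix k p))
               (F-single : ∀ {m} x → F m (single x)) where

  record Slotting (m c : ℕ) (p : Path n) : Set where
    constructor slotting
    field
      first    : Path n
      rest     : List (Path n)
      count    : length rest ≡ c
      chained  : Chained first rest
      first-ok : F m first
      rest-ok  : AllFrom F (suc m) rest
      concat   : concatP first rest ≡ p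

  suffix-slots : ∀ {m} k s ts → Chained s ts → F m s → AllFrom F (suc m) ts →
                 Slotting m (length ts) (suffix k (concatP s ts))
  suffix-slots k s []       _        fs _          = slotting (suffix k s) [] refl _ (F-suffix k s fs) _ refl
  suffix-slots k s (t ∷ ts) (e , ch) fs (ft , fts) with k ≤? ∣ s ∣ₚ
  ... | yes k≤ = slotting (suffix k s) (t ∷ ts) refl (trans (last-suffix k s) e , ch) (F-suffix k s fs) (ft , fts)
                   (sym (suffix-∘ₚ-≤ k s (concatP t ts) k≤))
  ... | no k≰  with suffix-slots (k ∸ ∣ s ∣ₚ) t ts ch ft fts
  ...   | slotting s′ ts′ count′ ch′ fs′ fts′ eq′ =
    slotting (single (head s′)) (s′ ∷ ts′) (cong suc count′) (refl , ch′) (F-single (head s′)) (fs′ , fts′) (begin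
      single (head s′) ∘ₚ concatP s′ ts′
        ≡⟨ single-∘ₚ (head s′) (concatP s′ ts′) (sym (head-concatP s′ ts′)) ⟩
      concatP s′ ts′
        ≡⟨ eq′ ⟩
      suffix (k ∸ ∣ s ∣ₚ) (concatP t ts)
        ≡⟨ sym (suffix-∘ₚ (k ∸ ∣ s ∣ₚ) s (concatP t ts) (trans e (sym (head-concatP t ts)))) ⟩
      suffix (∣ s ∣ₚ + (k ∸ ∣ s ∣ₚ)) (s ∘ₚ concatP t ts)
        ≡⟨ cong (λ k′ → suffix k′ (s ∘ₚ concatP t ts)) (m+[n∸m]≡n (≰⇒≥ k≰)) ⟩
      suffix k (s ∘ₚ concatP t ts) ∎)
    where open ≡-Reasoning

  suffix-slotting : ∀ {m c p} k → Slotting m c p → Slotting m c (suffix k p)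
  suffix-slotting k (slotting s ts refl ch fs fts refl) = suffix-slots k s ts ch fs fts

  prefix-slots : ∀ {m} k s ts → Chained s ts → F m s → AllFrom F (suc m) ts →
                 Slotting m (length ts) (prefix k (concatP s ts))
  prefix-slots k s []       _        fs _          = slotting (prefix k s) [] refl _ (F-prefix k s fs) _ refl
  prefix-slots {m} k s (t ∷ ts) (e , ch) fs (ft , fts) with k ≤? ∣ s ∣ₚ
  ... | yes k≤ =
    slotting (prefix k s) (replicate (suc (length ts)) (single x)) (List.length-replicate (suc (length ts)))
      (Chained-replicate (prefix k s) (suc (length ts)) x refl) (F-prefix k s fs)
      (AllFrom-replicate (λ _ → F-single x) (suc m) (suc (length ts)))
      (trans (concatP-replicate (prefix k s) (suc (length ts)) x) (sym (prefix-∘ₚ-≤ k s (concatP t ts) k≤)))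
    where x = last (prefix k s)
  ... | no k≰  with prefix-slots (k ∸ ∣ s ∣ₚ) t ts ch ft fts
  ...   | slotting s′ ts′ count′ ch′ fs′ fts′ eq′ =
    slotting s (s′ ∷ ts′) (cong suc count′) (joint , ch′) fs (fs′ , fts′) (begin
      s ∘ₚ concatP s′ ts′
        ≡⟨ cong (s ∘ₚ_) eq′ ⟩
      s ∘ₚ prefix (k ∸ ∣ s ∣ₚ) (concatP t ts)
        ≡⟨ sym (prefix-∘ₚ (k ∸ ∣ s ∣ₚ) s (concatP t ts)) ⟩
      prefix (∣ s ∣ₚ + (k ∸ ∣ s ∣ₚ)) (s ∘ₚ concatP t ts)
        ≡⟨ cong (λ k′ → prefix k′ (s ∘ₚ concatP t ts)) (m+[n∸m]≡n (≰⇒≥ k≰)) ⟩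
      prefix k (s ∘ₚ concatP t ts) ∎)
    where
    open ≡-Reasoning
    joint : last s ≡ head s′
    joint = trans e (sym (trans (sym (head-concatP s′ ts′)) (trans (cong head eq′) (head-concatP t ts))))

  module _ {R : Fin n → Fin n → Set} (F-path : ∀ {m p} → F m p → IsPath R p) where

    -- After simplifying the tail, cut the first slot at its first vertex on the simplified tail
    -- and the tail at that same vertex; the tail slots before the cut become trivial.
    simplify-slots : ∀ {m} s ts → Chained s ts → F m s → AllFrom F (suc m) ts →
                     ∃[ p ] IsPath R p × Slotting m (length ts) p × head p ≡ head s ×
                            last p ≡ last (concatP s ts) × ∣ p ∣ₚ ≤ ∣ concatP s ts ∣ₚ
    simplify-slots s [] _ fs _ = s , F-path fs , slotting s [] refl _ fs _ refl , refl , refl , ≤-refl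
    simplify-slots s (t ∷ ts) (e , ch) fs (ft , fts) with simplify-slots t ts ch ft fts
    ... | c , pc , sc , hc , lc , ∣c∣≤
      with shortcut s c (F-path fs) pc (subst (_∈ toList c) (sym (trans e (sym hc))) (here refl))
    ...   | p , k , pp , joint with suffix-slotting k sc
    ...     | slotting s′ ts′ count′ ch′ fs′ fts′ eq′ =
      prefix p s ∘ₚ suffix k c , pp ,
      slotting (prefix p s) (s′ ∷ ts′) (cong suc count′)
        (trans joint (trans (cong head (sym eq′)) (head-concatP s′ ts′)) , ch′)
        (F-prefix p s fs) (fs′ , fts′) (cong (prefix p s ∘ₚ_) eq′) ,
      refl ,
      (begin
        last (prefix p s ∘ₚ suffix k c) ≡⟨ last-∘ₚ (prefix p s) (suffix k c) joint ⟩
        last (suffix k c)               ≡⟨ last-suffix k c ⟩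
        last c                          ≡⟨ lc ⟩
        last (concatP t ts)             ≡⟨ sym (last-∘ₚ s (concatP t ts) (trans e (sym (head-concatP t ts)))) ⟩
        last (s ∘ₚ concatP t ts)        ∎) ,
      subst₂ _≤_ (sym (∣∘ₚ∣ (prefix p s) (suffix k c))) (sym (∣∘ₚ∣ s (concatP t ts)))
        (+-mono-≤ (∣prefix∣≤ p s) (≤-trans (∣suffix∣≤ k c) ∣c∣≤))
      where
      open ≡-Reasoning

    simplify : ∀ {m c w} → Slotting m c w →
               ∃[ p ] IsPath R p × Slotting m c p × head p ≡ head w × last p ≡ last w × ∣ p ∣ₚ ≤ ∣ w ∣ₚ
    simplify (slotting s ts refl ch fs fts refl) with simplify-slots s ts ch fs fts
    ... | p , pp , sp , hp , lp , ∣p∣≤ = p , pp , sp , trans hp (sym (head-concatP s ts)) , lp , ∣p∣≤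

module _ {n : ℕ} (G : Graph n) (A : EdgeSet n) (ℓ : ℕ) where

  private
    Shortest : ℕ → Path n → Set
    Shortest _ = IsShortest G

  open Slotted Shortest (shortest-prefix G) (shortest-suffix G) (shortest-single G)

  decomposable-single : ∀ x → IsDecomposable G A ℓ (single x)
  decomposable-single x = path-single x , single x , [] , s≤s z≤n , shortest-single G x , [] , _ , refl

  decomposable-prefix : ∀ k p → IsDecomposable G A ℓ p → IsDecomposable G A ℓ (prefix k p)
  decomposable-prefix k _ (pp , s , ts , count≤ , sh , ash , ch , refl)
    with prefix-slots {0} k s ts ch sh (All⇒AllFrom ash)
  ... | slotting s′ ts′ count′ ch′ sh′ ash′ eq′ =
    path-prefix k _ pp , s′ , ts′ , subst (λ c → suc c ≤ suc ℓ) (sym count′) count≤ ,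
    sh′ , AllFrom⇒All ts′ ash′ , ch′ , sym eq′

  decomposable-suffix : ∀ k p → IsDecomposable G A ℓ p → IsDecomposable G A ℓ (suffix k p)
  decomposable-suffix k _ (pp , s , ts , count≤ , sh , ash , ch , refl)
    with suffix-slots {0} k s ts ch sh (All⇒AllFrom ash)
  ... | slotting s′ ts′ count′ ch′ sh′ ash′ eq′ =
    path-suffix k _ pp , s′ , ts′ , subst (λ c → suc c ≤ suc ℓ) (sym count′) count≤ ,
    sh′ , AllFrom⇒All ts′ ash′ , ch′ , sym eq′

module _ {n : ℕ} {R : Fin n → Fin n → Set} (R-sym : ∀ {x y} → R x y → R y x) where
  open DecMembership (_≟ᶠ_ {n}) using (_∈?_)

  reversed-path : ∀ w → IsWalk R w →
                  ∃[ p ] IsPath R p × head p ≡ last w × last p ≡ head w × ∣ p ∣ₚ ≤ ∣ w ∣ₚ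
  reversed-path (x ∷ xs) ww with go (single x) xs (path-single x) ww
    where
    -- trail is a path from the current vertex of the walk back to its start
    go : ∀ trail xs → IsPath R trail → Linked R (head trail ∷ xs) →
         ∃[ p ] IsPath R p × head p ≡ lastFrom (head trail) xs × last p ≡ last trail × ∣ p ∣ₚ ≤ ∣ trail ∣ₚ + length xs
    go trail [] pa _ = trail , pa , refl , refl , m≤m+n ∣ trail ∣ₚ 0
    go trail (y ∷ ys) pa (r ∷ lk) with y ∈? toList trail
    ... | yes y∈ with ∈⇒suffix trail y∈
    ...   | k , _ , e
      with go (suffix k trail) ys (path-suffix k trail pa) (subst (λ z → Linked R (z ∷ ys)) (sym e) lk)
    ...     | p , pp , hp , lp , ∣p∣≤ =
      p , pp , trans hp (cong (λ z → lastFrom z ys) e) , trans lp (last-suffix k trail) ,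
      ≤-trans ∣p∣≤ (+-mono-≤ (∣suffix∣≤ k trail) (n≤1+n (length ys)))
    go trail (y ∷ ys) (wa , ua) (r ∷ lk) | no y∉
      with go (y ∷ toList trail) ys (R-sym r ∷ wa , All.tabulate fresh ∷ ua) lk
      where
      fresh : ∀ {z} → z ∈ toList trail → y ≢ z
      fresh z∈ refl = y∉ z∈
    ... | p , pp , hp , lp , ∣p∣≤ =
      p , pp , hp , trans lp (last-∷∷ y (head trail) (tail trail)) ,
      ≤-trans ∣p∣≤ (≤-reflexive (sym (+-suc ∣ trail ∣ₚ (length ys))))
  ... | p , pp , hp , lp , ∣p∣≤ = p , pp , trans hp (sym (last-∷ (x ∷ xs))) , lp , ∣p∣≤

  walk⇒path : ∀ w → IsWalk R w →
              ∃[ p ] IsPath R p × head p ≡ head w × last p ≡ last w × ∣ p ∣ₚ ≤ ∣ w ∣ₚ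
  walk⇒path w ww with reversed-path w ww
  ... | q , (wq , _) , hq , lq , ∣q∣≤ with reversed-path q wq
  ...   | p , pp , hp , lp , ∣p∣≤ = p , pp , trans hp lq , trans lp hq , ≤-trans ∣p∣≤ ∣q∣≤

lookup-injective : ∀ {n} (xs : List (Fin n)) → Unique xs → ∀ i j → lookup xs i ≡ lookup xs j → i ≡ j
lookup-injective (x ∷ xs) (_    ∷ _) fzero    fzero    _ = refl
lookup-injective (x ∷ xs) (x∉ ∷ _)  fzero    (fsuc j) e = ⊥-elim (All.lookup x∉ (∈-lookup j) e)
lookup-injective (x ∷ xs) (x∉ ∷ _)  (fsuc i) fzero    e = ⊥-elim (All.lookup x∉ (∈-lookup i) (sym e))
lookup-injective (x ∷ xs) (_ ∷ u)   (fsuc i) (fsuc j) e = cong fsuc (lookup-injective xs u i j e)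

length-unique≤ : ∀ {n} (xs : List (Fin n)) → Unique xs → length xs ≤ n
length-unique≤ {n} xs u with length xs ≤? n
... | yes ≤n = ≤n
... | no  ≰n with pigeonhole (≰⇒> ≰n) (lookup xs)
...   | i , j , i<j , e = ⊥-elim (<⇒≢ᶠ i<j (lookup-injective xs u i j e))

∣path∣<n : ∀ {n} {R : Fin n → Fin n → Set} p → IsPath R p → ∣ p ∣ₚ < n
∣path∣<n p (_ , u) = length-unique≤ (toList p) u

n≤2^⌈log₂n⌉ : ∀ n → n ≤ 2 ^ ⌈log₂ n ⌉
n≤2^⌈log₂n⌉ n = go n (<-wellFounded n)
  where
  go : ∀ m (acc : Acc _<_ m) → m ≤ 2 ^ ⌈log2⌉ m acc
  go zero          _         = z≤n
  go (suc zero)    _         = s≤s z≤n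
  go (suc (suc m)) (acc rec) = begin
    suc (suc m)                 ≤⟨ s≤s (s≤s (subst (_≤ c + c) (⌊n/2⌋+⌈n/2⌉≡n m) (+-monoˡ-≤ c (⌊n/2⌋≤⌈n/2⌉ m)))) ⟩
    suc (suc (c + c))           ≡⟨ cong suc (sym (+-suc c c)) ⟩
    suc c + suc c               ≤⟨ +-mono-≤ ih (≤-trans ih (≤-reflexive (sym (+-identityʳ _)))) ⟩
    2 ^ suc ⌈log2⌉[1+c]         ∎
    where
    open ≤-Reasoning
    c : ℕ
    c = ⌈ m /2⌉
    ⌈log2⌉[1+c] : ℕ
    ⌈log2⌉[1+c] = ⌈log2⌉ (suc c) (rec (⌈n/2⌉<n m))
    ih : suc c ≤ 2 ^ ⌈log2⌉[1+c]
    ih = go (suc c) (rec (⌈n/2⌉<n m))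

module _ {n : ℕ} where

  geometric-sum : ∀ m (ts : List (Path n)) → AllFrom (λ k t → ∣ t ∣ₚ ≤ 2 ^ k) m ts →
                  ∣ ts ∣ₛ + 2 ^ m ≤ 2 ^ (m + length ts)
  geometric-sum m []       _           = ≤-reflexive (cong (2 ^_) (sym (+-identityʳ m)))
  geometric-sum m (t ∷ ts) (∣t∣≤ , all) = begin
    ∣ t ∣ₚ + ∣ ts ∣ₛ + 2 ^ m     ≤⟨ +-monoˡ-≤ (2 ^ m) (+-monoˡ-≤ ∣ ts ∣ₛ ∣t∣≤) ⟩
    2 ^ m + ∣ ts ∣ₛ + 2 ^ m      ≡⟨ regroup (2 ^ m) ∣ ts ∣ₛ ⟩
    ∣ ts ∣ₛ + 2 ^ suc m          ≤⟨ geometric-sum (suc m) ts all ⟩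
    2 ^ (suc m + length ts)      ≡⟨ cong (2 ^_) (sym (+-suc m (length ts))) ⟩
    2 ^ (m + suc (length ts))    ∎
    where
    open ≤-Reasoning
    regroup : ∀ a s → a + s + a ≡ s + 2 * a
    regroup = solve-∀

  geometric-sum-mirrored : ∀ K m (ts : List (Path n)) → m + length ts ≡ suc K →
                           AllFrom (λ k t → ∣ t ∣ₚ ≤ 2 ^ (K ∸ k)) m ts → ∣ ts ∣ₛ + 1 ≤ 2 ^ length ts
  geometric-sum-mirrored K m []       _ _            = ≤-refl
  geometric-sum-mirrored K m (t ∷ ts) e (∣t∣≤ , all) = begin
    ∣ t ∣ₚ + ∣ ts ∣ₛ + 1          ≤⟨ +-monoˡ-≤ 1 (+-monoˡ-≤ ∣ ts ∣ₛ (subst (λ k → ∣ t ∣ₚ ≤ 2 ^ k) K∸m≡ ∣t∣≤)) ⟩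
    2 ^ length ts + ∣ ts ∣ₛ + 1   ≡⟨ +-assoc (2 ^ length ts) ∣ ts ∣ₛ 1 ⟩
    2 ^ length ts + (∣ ts ∣ₛ + 1) ≤⟨ +-monoʳ-≤ (2 ^ length ts) (geometric-sum-mirrored K (suc m) ts e′ all) ⟩
    2 ^ length ts + 2 ^ length ts ≡⟨ cong (2 ^ length ts +_) (sym (+-identityʳ (2 ^ length ts))) ⟩
    2 ^ suc (length ts)           ∎
    where
    open ≤-Reasoning
    e′ : suc m + length ts ≡ suc K
    e′ = trans (sym (+-suc m (length ts))) e
    K∸m≡ : K ∸ m ≡ length ts
    K∸m≡ = trans (cong (_∸ m) (suc-injective (sym e′))) (m+n∸m≡n m (length ts))

module _ {n : ℕ} where

  split-sum : ∀ (ts : List (Path n)) e → e < ∣ ts ∣ₛ →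
              ∃₂ λ pre b → ∃₂ λ post t → ts ≡ pre ++ b ∷ post × e ≡ ∣ pre ∣ₛ + t × t < ∣ b ∣ₚ
  split-sum (t ∷ ts) e e< with e <? ∣ t ∣ₚ
  ... | yes e<∣t∣ = [] , t , ts , e , refl , refl , e<∣t∣
  ... | no  e≮∣t∣ with split-sum ts (e ∸ ∣ t ∣ₚ) (+-cancelˡ-< ∣ t ∣ₚ _ _ (subst (_< ∣ t ∣ₚ + ∣ ts ∣ₛ) (sym e≡) e<))
    where
    e≡ : ∣ t ∣ₚ + (e ∸ ∣ t ∣ₚ) ≡ e
    e≡ = m+[n∸m]≡n (≮⇒≥ e≮∣t∣)
  ...   | pre , b , post , o , refl , e∸≡ , o< =
    t ∷ pre , b , post , o , refl ,
    trans (sym (m+[n∸m]≡n (≮⇒≥ e≮∣t∣))) (trans (cong (∣ t ∣ₚ +_) e∸≡) (sym (+-assoc ∣ t ∣ₚ ∣ pre ∣ₛ o))) , o<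

<∸⇒+< : ∀ {a} m i → a < m ∸ i → i + a < m
<∸⇒+< m       zero    a< = a<
<∸⇒+< zero    (suc i) ()
<∸⇒+< (suc m) (suc i) a< = s≤s (<∸⇒+< m i a<)

-- For j = k + 1, either 2^k < d, and then 2^(j+1) < 4d already suffices, or an exchange at
-- scale k (or at L, if k > L) applies.
doubling-bound : ∀ {Λ x d L} j → Λ < x → x + 2 ≤ Λ + 2 ^ suc j → d ≤ 2 ^ L →
                 (∀ k → k < j → k ≤ L → d ≤ 2 ^ k → x ≤ Λ + d) → x ≤ 4 * d + Λ
doubling-bound {Λ} {x} zero Λ<x x+2≤ _ _ =
  ⊥-elim (<⇒≱ Λ<x (+-cancelʳ-≤ 2 x Λ x+2≤))
doubling-bound {Λ} {x} {d} {L} (suc k) Λ<x x+2≤ d≤2^L exchange with 2 ^ k <? d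
... | yes 2^k<d = +-cancelʳ-≤ 2 x (4 * d + Λ) (begin
  x + 2                  ≤⟨ x+2≤ ⟩
  Λ + 2 * (2 * 2 ^ k)    ≡⟨ cong (Λ +_) (sym (*-assoc 2 2 (2 ^ k))) ⟩
  Λ + 4 * 2 ^ k          ≤⟨ +-monoʳ-≤ Λ (*-monoʳ-≤ 4 (<⇒≤ 2^k<d)) ⟩
  Λ + 4 * d              ≡⟨ +-comm Λ (4 * d) ⟩
  4 * d + Λ              ≤⟨ m≤m+n (4 * d + Λ) 2 ⟩
  4 * d + Λ + 2          ∎)
  where open ≤-Reasoning
... | no 2^k≮d = ≤-trans exchanged (≤-trans (+-monoʳ-≤ Λ (m≤n*m d 4)) (≤-reflexive (+-comm Λ (4 * d))))
  where
  exchanged : x ≤ Λ + d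
  exchanged with k ≤? L
  ... | yes k≤L = exchange k ≤-refl k≤L (≮⇒≥ 2^k≮d)
  ... | no  k≰L = exchange L (s≤s (<⇒≤ (≰⇒> k≰L))) ≤-refl d≤2^L

module ShortestExpath {n : ℕ} (G : Graph n) (A : EdgeSet n) (ℓ Λ : ℕ) where

  R : Fin n → Fin n → Set
  R = AdjMinus G A

  L N : ℕ
  L = logn n
  N = suc (2 * L)

  Block : ℕ → Path n → Set
  Block m p = IsDecomposable G A ℓ p × ∣ p ∣ₚ ≤ (2 ^ m) ⊓ (2 ^ (2 * L ∸ m))

  -- slot 0 is Pa, slot 1 + m is the m-th block of Pb, slot 1 + N is Pc
  Slot : ℕ → Path n → Set
  Slot zero    p = IsPath R p × ∣ p ∣ₚ ≤ Λ
  Slot (suc m) p = IsPath R p × (m < N → Block m p) × (N ≤ m → ∣ p ∣ₚ ≤ Λ)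

  slot-path : ∀ {m p} → Slot m p → IsPath R p
  slot-path {zero}  (pp , _) = pp
  slot-path {suc m} (pp , _) = pp

  slot-shrink : ∀ (f : Path n → Path n) → (∀ p → IsPath R p → IsPath R (f p)) →
                (∀ p → IsDecomposable G A ℓ p → IsDecomposable G A ℓ (f p)) → (∀ p → ∣ f p ∣ₚ ≤ ∣ p ∣ₚ) →
                ∀ {m} p → Slot m p → Slot m (f p)
  slot-shrink f f-path f-dec f-≤ {zero}  p (pp , ∣p∣≤)          = f-path p pp , ≤-trans (f-≤ p) ∣p∣≤
  slot-shrink f f-path f-dec f-≤ {suc m} p (pp , block , short) =
    f-path p pp ,
    (λ m<N → f-dec p (proj₁ (block m<N)) , ≤-trans (f-≤ p) (proj₂ (block m<N))) ,
    (λ N≤m → ≤-trans (f-≤ p) (short N≤m))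

  slot-prefix : ∀ {m} k p → Slot m p → Slot m (prefix k p)
  slot-prefix k = slot-shrink (prefix k) (path-prefix k) (decomposable-prefix G A ℓ k) (∣prefix∣≤ k)

  slot-suffix : ∀ {m} k p → Slot m p → Slot m (suffix k p)
  slot-suffix k = slot-shrink (suffix k) (path-suffix k) (decomposable-suffix G A ℓ k) (∣suffix∣≤ k)

  slot-single : ∀ {m} x → Slot m (single x)
  slot-single {zero}  x = path-single x , z≤n
  slot-single {suc m} x = path-single x , (λ _ → decomposable-single G A ℓ x , z≤n) , (λ _ → z≤n)

  open Slotted Slot slot-prefix slot-suffix slot-single public

  slotting⇒expath : ∀ {p} → IsPath R p → Slotting 0 (suc N) p → IsExpath G A ℓ Λ p
  slotting⇒expath pp (slotting s ts count ch (_ , ∣s∣≤) slots refl) with initLast ts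
  ... | bl ∷ʳ′ pc with AllFrom-++⁻ 1 bl (pc ∷ []) slots
  ...   | bl-slots , (pc-slot , _) with AllFrom-vector 1 bl ∣bl∣≡ bl-slots
    where
    ∣bl∣≡ : length bl ≡ N
    ∣bl∣≡ = suc-injective (trans (sym (trans (List.length-++ bl) (+-comm (length bl) 1))) count)
  ...     | bs , refl , bs-slots =
    pp , s , bs , pc , ∣s∣≤ , proj₂ (proj₂ (subst (λ k → Slot (suc k) pc) (List.length-tabulate bs) pc-slot)) ≤-refl ,
    (λ i → proj₁ (proj₂ (bs-slots i)) (toℕ<n i)) , ch , refl

  shortest-expath-≤ : ∀ {b b′ P w} → IsShortestExpath G A ℓ Λ b b′ P →
                      Slotting 0 (suc N) w → head w ≡ b → last w ≡ b′ → ∣ P ∣ₚ ≤ ∣ w ∣ₚ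
  shortest-expath-≤ (_ , _ , _ , minimal) sw hw lw with simplify slot-path sw
  ... | p , pp , sp , hp , lp , ∣p∣≤ = ≤-trans (minimal p (slotting⇒expath pp sp) (trans hp hw) (trans lp lw)) ∣p∣≤

  R-sym : ∀ {x y} → R x y → R y x
  R-sym (xy , ¬Axy , ¬Ayx) = Graph.sym G xy , ¬Ayx , ¬Axy

  ∣decomposable∣≤2^L : ∀ Q → IsDecomposable G A ℓ Q → ∣ Q ∣ₚ ≤ 2 ^ L
  ∣decomposable∣≤2^L Q dQ = ≤-trans (<⇒≤ (∣path∣<n Q (proj₁ dQ))) (n≤2^⌈log₂n⌉ n)

  slot-of-block : ∀ {m Q} → m < N → Block m Q → Slot (suc m) Q
  slot-of-block m<N bl = proj₁ (proj₁ bl) , (λ _ → bl) , (λ N≤m → ⊥-elim (<⇒≱ m<N N≤m))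

  block-early : ∀ {k Q} → k ≤ L → IsDecomposable G A ℓ Q → ∣ Q ∣ₚ ≤ 2 ^ k → Block k Q
  block-early {k} {Q} k≤L dQ ∣Q∣≤ = dQ , ⊓-glb ∣Q∣≤ (≤-trans (∣decomposable∣≤2^L Q dQ) (^-monoʳ-≤ 2 L≤))
    where
    L≤ : L ≤ 2 * L ∸ k
    L≤ = subst (_≤ 2 * L ∸ k) (trans (m+n∸m≡n L (L + 0)) (+-identityʳ L)) (∸-monoʳ-≤ (2 * L) k≤L)

  block-late : ∀ {m k Q} → m + k ≡ 2 * L → k ≤ L → IsDecomposable G A ℓ Q → ∣ Q ∣ₚ ≤ 2 ^ k → Block m Q
  block-late {m} {k} {Q} m+k≡ k≤L dQ ∣Q∣≤ =
    dQ , ⊓-glb (≤-trans (∣decomposable∣≤2^L Q dQ) (^-monoʳ-≤ 2 L≤m)) (subst (λ e → ∣ Q ∣ₚ ≤ 2 ^ e) (sym 2L∸m≡k) ∣Q∣≤)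
    where
    L≤m : L ≤ m
    L≤m = +-cancelʳ-≤ k L m (≤-trans (+-monoʳ-≤ L k≤L)
            (≤-reflexive (trans (cong (L +_) (sym (+-identityʳ L))) (sym m+k≡))))
    2L∸m≡k : 2 * L ∸ m ≡ k
    2L∸m≡k = trans (cong (_∸ m) (sym m+k≡)) (m+n∸m≡n m k)

  record Located (P : Path n) (i : ℕ) : Set where
    field
      pa pc b    : Path n
      pre post   : List (Path n)
      t          : ℕ
      split      : P ≡ concatP pa (pre ++ b ∷ post ++ pc ∷ [])
      chained    : Chained pa (pre ++ b ∷ post ++ pc ∷ [])
      count      : length pre + suc (length post) ≡ N
      pa-slot    : Slot 0 pa
      pc-short   : ∣ pc ∣ₚ ≤ Λ
      slots      : AllFrom Slot 1 (pre ++ b ∷ post ++ pc ∷ [])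
      blocks     : AllFrom Block 0 (pre ++ b ∷ post)
      offset     : i ≡ ∣ pa ∣ₚ + ∣ pre ∣ₛ + t
      t<∣b∣      : t < ∣ b ∣ₚ

  locate : ∀ {P} → IsExpath G A ℓ Λ P → ∀ i → Λ ≤ i → i + Λ < ∣ P ∣ₚ → Located P i
  locate (pp , pa , bs , pc , ∣pa∣≤ , ∣pc∣≤ , bs-blocks , ch , refl) i Λ≤i i+Λ<
    with split-sum (VF.toList bs) (i ∸ ∣ pa ∣ₚ) e<
    where
    ∣P∣≤ : ∣ concatP pa (VF.toList bs ++ pc ∷ []) ∣ₚ ≤ ∣ pa ∣ₚ + ∣ VF.toList bs ∣ₛ + Λ
    ∣P∣≤ = begin
      ∣ concatP pa (VF.toList bs ++ pc ∷ []) ∣ₚ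
        ≡⟨ ∣concatP∣ pa (VF.toList bs ++ pc ∷ []) ⟩
      ∣ pa ∣ₚ + ∣ VF.toList bs ++ pc ∷ [] ∣ₛ
        ≡⟨ cong (∣ pa ∣ₚ +_) (∣++∣ₛ (VF.toList bs) (pc ∷ [])) ⟩
      ∣ pa ∣ₚ + (∣ VF.toList bs ∣ₛ + (∣ pc ∣ₚ + 0))
        ≡⟨ sym (+-assoc ∣ pa ∣ₚ _ _) ⟩
      ∣ pa ∣ₚ + ∣ VF.toList bs ∣ₛ + (∣ pc ∣ₚ + 0)
        ≤⟨ +-monoʳ-≤ (∣ pa ∣ₚ + ∣ VF.toList bs ∣ₛ) (≤-trans (≤-reflexive (+-identityʳ _)) ∣pc∣≤) ⟩
      ∣ pa ∣ₚ + ∣ VF.toList bs ∣ₛ + Λ ∎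
      where open ≤-Reasoning
    e< : i ∸ ∣ pa ∣ₚ < ∣ VF.toList bs ∣ₛ
    e< = +-cancelˡ-< ∣ pa ∣ₚ _ _ (subst (_< ∣ pa ∣ₚ + ∣ VF.toList bs ∣ₛ) (sym (m+[n∸m]≡n (≤-trans ∣pa∣≤ Λ≤i)))
           (+-cancelʳ-< Λ i _ (≤-trans i+Λ< ∣P∣≤)))
  ... | pre , b , post , t , bs≡ , e≡ , t< = record
    { pa = pa ; pc = pc ; b = b ; pre = pre ; post = post ; t = t
    ; split = cong (concatP pa) slots≡
    ; chained = subst (Chained pa) slots≡ ch
    ; count = trans (sym (List.length-++ pre)) (trans (cong length (sym bs≡)) (List.length-tabulate bs))
    ; pa-slot = proj₁ paths , ∣pa∣≤
    ; pc-short = ∣pc∣≤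
    ; slots = subst (AllFrom Slot 1) slots≡ (AllFrom-++⁺ 1 (VF.toList bs) (pc ∷ []) bs-slots (pc-slot , _))
    ; blocks = subst (AllFrom Block 0) bs≡ (AllFrom-tabulate⁺ 0 bs bs-blocks)
    ; offset = trans (sym (m+[n∸m]≡n (≤-trans ∣pa∣≤ Λ≤i)))
                     (trans (cong (∣ pa ∣ₚ +_) e≡) (sym (+-assoc ∣ pa ∣ₚ ∣ pre ∣ₛ t)))
    ; t<∣b∣ = t< }
    where
    slots≡ : VF.toList bs ++ pc ∷ [] ≡ pre ++ b ∷ post ++ pc ∷ []
    slots≡ = trans (cong (_++ pc ∷ []) bs≡) (List.++-assoc pre (b ∷ post) (pc ∷ []))
    paths : IsPath R pa × All (IsPath R) (VF.toList bs ++ pc ∷ [])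
    paths = slot-paths pa (VF.toList bs ++ pc ∷ []) ch pp
    bs-slots : AllFrom Slot 1 (VF.toList bs)
    bs-slots = AllFrom-tabulate⁺ 1 bs (λ i → slot-of-block (toℕ<n i) (bs-blocks i))
    pc-slot : Slot (1 + length (VF.toList bs)) pc
    pc-slot = subst (λ k → Slot (suc k) pc) (sym (List.length-tabulate bs))
                (All.lookup (proj₂ paths) (∈-++⁺ʳ (VF.toList bs) (here refl)) ,
                 (λ N<N → ⊥-elim (n≮n N N<N)) , (λ _ → ∣pc∣≤))

  module AtLocation {P i} (loc : Located P i) where
    open Located loc public

    j : ℕ
    j = length pre

    rest : List (Path n)
    rest = post ++ pc ∷ []

    front : Path n
    front = concatP pa pre

    ∣front∣ : ∣ front ∣ₚ ≡ ∣ pa ∣ₚ + ∣ pre ∣ₛ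
    ∣front∣ = ∣concatP∣ pa pre

    P≡ : P ≡ front ∘ₚ concatP b rest
    P≡ = trans split (concatP-++ pa pre b rest)

    pre-chained : Chained pa pre
    pre-chained = proj₁ (Chained-++⁻ pa pre b rest chained)

    pre-joint : last (lastSlot pa pre) ≡ head b
    pre-joint = proj₁ (proj₂ (Chained-++⁻ pa pre b rest chained))

    front-joint : last front ≡ head b
    front-joint = trans (last-concatP pa pre pre-chained) pre-joint

    b-chained : Chained b rest
    b-chained = proj₂ (proj₂ (Chained-++⁻ pa pre b rest chained))

    pre-slots : AllFrom Slot 1 pre
    pre-slots = proj₁ (AllFrom-++⁻ 1 pre (b ∷ rest) slots)

    b-slot : Slot (suc j) b
    b-slot = proj₁ (proj₂ (AllFrom-++⁻ 1 pre (b ∷ rest) slots))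

    rest-slots : AllFrom Slot (suc (suc j)) rest
    rest-slots = proj₂ (proj₂ (AllFrom-++⁻ 1 pre (b ∷ rest) slots))

    pre-blocks : AllFrom Block 0 pre
    pre-blocks = proj₁ (AllFrom-++⁻ 0 pre (b ∷ post) blocks)

    b∷post-blocks : AllFrom Block j (b ∷ post)
    b∷post-blocks = proj₂ (AllFrom-++⁻ 0 pre (b ∷ post) blocks)

    at : ℕ → ℕ
    at o = ∣ pa ∣ₚ + ∣ pre ∣ₛ + o

    at≤∣P∣ : ∀ o → o ≤ ∣ b ∣ₚ → at o ≤ ∣ P ∣ₚ
    at≤∣P∣ o o≤ = begin
      ∣ pa ∣ₚ + ∣ pre ∣ₛ + o
        ≤⟨ +-mono-≤ (≤-reflexive (sym ∣front∣)) (≤-trans o≤ (m≤m+n ∣ b ∣ₚ ∣ rest ∣ₛ)) ⟩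
      ∣ front ∣ₚ + (∣ b ∣ₚ + ∣ rest ∣ₛ)
        ≡⟨ cong (∣ front ∣ₚ +_) (sym (∣concatP∣ b rest)) ⟩
      ∣ front ∣ₚ + ∣ concatP b rest ∣ₚ
        ≡⟨ sym (∣∘ₚ∣ front (concatP b rest)) ⟩
      ∣ front ∘ₚ concatP b rest ∣ₚ
        ≡⟨ cong ∣_∣ₚ (sym P≡) ⟩
      ∣ P ∣ₚ ∎
      where open ≤-Reasoning

    suffix-at : ∀ o → o ≤ ∣ b ∣ₚ → suffix (at o) P ≡ concatP (suffix o b) rest
    suffix-at o o≤ = begin
      suffix (at o) P
        ≡⟨ cong₂ (λ k p → suffix (k + o) p) (sym ∣front∣) P≡ ⟩
      suffix (∣ front ∣ₚ + o) (front ∘ₚ concatP b rest)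
        ≡⟨ suffix-∘ₚ o front (concatP b rest) (trans front-joint (sym (head-concatP b rest))) ⟩
      suffix o (concatP b rest)
        ≡⟨ suffix-concatP o b rest o≤ ⟩
      concatP (suffix o b) rest ∎
      where open ≡-Reasoning

    prefix-at : ∀ o → o ≤ ∣ b ∣ₚ → prefix (at o) P ≡ front ∘ₚ prefix o b
    prefix-at o o≤ = begin
      prefix (at o) P                                 ≡⟨ cong₂ (λ k p → prefix (k + o) p) (sym ∣front∣) P≡ ⟩
      prefix (∣ front ∣ₚ + o) (front ∘ₚ concatP b rest) ≡⟨ prefix-∘ₚ o front (concatP b rest) ⟩
      front ∘ₚ prefix o (concatP b rest)              ≡⟨ cong (front ∘ₚ_) (prefix-concatP o b rest o≤) ⟩
      front ∘ₚ prefix o b                             ∎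
      where open ≡-Reasoning

    head-suffix-at : ∀ o → o ≤ ∣ b ∣ₚ → head (suffix (at o) P) ≡ head (suffix o b)
    head-suffix-at o o≤ = trans (cong head (suffix-at o o≤)) (head-concatP (suffix o b) rest)

    before-bound : i + 2 ≤ Λ + 2 ^ suc j
    before-bound = begin
      i + 2
        ≡⟨ cong (_+ 2) offset ⟩
      ∣ pa ∣ₚ + ∣ pre ∣ₛ + t + 2
        ≡⟨ regroup ∣ pa ∣ₚ ∣ pre ∣ₛ t ⟩
      ∣ pa ∣ₚ + (∣ pre ∣ₛ + 2 ^ 0) + suc t
        ≤⟨ +-mono-≤ (+-mono-≤ (proj₂ pa-slot) pre-sum) (≤-trans t<∣b∣ ∣b∣≤) ⟩
      Λ + 2 ^ j + 2 ^ j
        ≡⟨ +-assoc Λ (2 ^ j) (2 ^ j) ⟩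
      Λ + (2 ^ j + 2 ^ j)
        ≡⟨ cong (λ x → Λ + (2 ^ j + x)) (sym (+-identityʳ (2 ^ j))) ⟩
      Λ + 2 ^ suc j ∎
      where
      open ≤-Reasoning
      regroup : ∀ a s t → a + s + t + 2 ≡ a + (s + 1) + suc t
      regroup = solve-∀
      pre-sum : ∣ pre ∣ₛ + 2 ^ 0 ≤ 2 ^ j
      pre-sum = geometric-sum 0 pre (AllFrom-map (λ bl → ≤-trans (proj₂ bl) (m⊓n≤m _ _)) pre-blocks)
      ∣b∣≤ : ∣ b ∣ₚ ≤ 2 ^ j
      ∣b∣≤ = ≤-trans (proj₂ (proj₁ b∷post-blocks)) (m⊓n≤m _ _)

    suc-offset : suc i ≡ at (suc t)
    suc-offset = trans (cong suc offset) (sym (+-suc (∣ pa ∣ₚ + ∣ pre ∣ₛ) t))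

    after-bound : ∣ P ∣ₚ ∸ suc i + 2 ≤ Λ + 2 ^ suc (length post)
    after-bound = begin
      ∣ P ∣ₚ ∸ suc i + 2
        ≡⟨ cong (λ e → ∣ P ∣ₚ ∸ e + 2) suc-offset ⟩
      ∣ P ∣ₚ ∸ at (suc t) + 2
        ≡⟨ cong (_+ 2) (sym (∣suffix∣ (at (suc t)) P)) ⟩
      ∣ suffix (at (suc t)) P ∣ₚ + 2
        ≡⟨ cong (λ p → ∣ p ∣ₚ + 2) (suffix-at (suc t) t<∣b∣) ⟩
      ∣ concatP (suffix (suc t) b) rest ∣ₚ + 2
        ≡⟨ cong (_+ 2) (∣concatP∣ (suffix (suc t) b) rest) ⟩
      ∣ suffix (suc t) b ∣ₚ + ∣ rest ∣ₛ + 2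
        ≡⟨ cong (λ x → ∣ suffix (suc t) b ∣ₚ + x + 2) (∣++∣ₛ post (pc ∷ [])) ⟩
      ∣ suffix (suc t) b ∣ₚ + (∣ post ∣ₛ + (∣ pc ∣ₚ + 0)) + 2
        ≡⟨ regroup ∣ suffix (suc t) b ∣ₚ ∣ post ∣ₛ ∣ pc ∣ₚ ⟩
      ∣ pc ∣ₚ + ((∣ suffix (suc t) b ∣ₚ + 1) + ∣ post ∣ₛ + 1)
        ≤⟨ +-mono-≤ pc-short (+-monoˡ-≤ 1 (+-monoˡ-≤ ∣ post ∣ₛ ∣suffix∣<)) ⟩
      Λ + (∣ b ∣ₚ + ∣ post ∣ₛ + 1)
        ≤⟨ +-monoʳ-≤ Λ (geometric-sum-mirrored (2 * L) j (b ∷ post) count post-bounds) ⟩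
      Λ + 2 ^ suc (length post) ∎
      where
      open ≤-Reasoning
      regroup : ∀ a s c → a + (s + (c + 0)) + 2 ≡ c + ((a + 1) + s + 1)
      regroup = solve-∀
      post-bounds : AllFrom (λ k p → ∣ p ∣ₚ ≤ 2 ^ (2 * L ∸ k)) j (b ∷ post)
      post-bounds = AllFrom-map (λ bl → ≤-trans (proj₂ bl) (m⊓n≤n _ _)) b∷post-blocks
      ∣suffix∣< : ∣ suffix (suc t) b ∣ₚ + 1 ≤ ∣ b ∣ₚ
      ∣suffix∣< = begin
        ∣ suffix (suc t) b ∣ₚ + 1   ≡⟨ cong (_+ 1) (∣suffix∣ (suc t) b) ⟩
        ∣ b ∣ₚ ∸ suc t + 1          ≤⟨ +-monoʳ-≤ (∣ b ∣ₚ ∸ suc t) (s≤s z≤n) ⟩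
        ∣ b ∣ₚ ∸ suc t + suc t      ≡⟨ m∸n+n≡m t<∣b∣ ⟩
        ∣ b ∣ₚ                      ∎

    -- Q becomes block k; all other blocks before the rest of b are trivial.
    competitor-before : ∀ {u} w → Slot 0 w → last w ≡ u →
                        ∀ Q k c → suc k + c ≡ j → Slot (suc k) Q → head Q ≡ u → last Q ≡ head (suffix i P) →
                        Slotting 0 (suc N) (w ∘ₚ (Q ∘ₚ suffix i P))
    competitor-before {u} w w-slot lw Q k c j≡ Q-slot hQ lQ =
      slotting w layout count′ chained′ w-slot slots-ok concat′
      where
      y : Fin n
      y = head (suffix i P)
      X≡ : suffix i P ≡ concatP (suffix t b) rest
      X≡ = trans (cong (λ e → suffix e P) offset) (suffix-at t (<⇒≤ t<∣b∣))
      R₁ : List (Path n)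
      R₁ = replicate c (single y) ++ suffix t b ∷ rest
      layout : List (Path n)
      layout = replicate k (single u) ++ Q ∷ R₁
      count′ : length layout ≡ suc N
      count′ = begin
        length layout
          ≡⟨ length-singles k u (Q ∷ R₁) ⟩
        k + suc (length R₁)
          ≡⟨ cong (λ e → k + suc e) (length-singles c y (suffix t b ∷ rest)) ⟩
        k + suc (c + suc (length rest))
          ≡⟨ cong (λ e → k + suc (c + suc e)) (List.length-++ post) ⟩
        k + suc (c + suc (length post + 1))
          ≡⟨ regroup k c (length post) ⟩
        suc (suc k + c + suc (length post))
          ≡⟨ cong (λ e → suc (e + suc (length post))) j≡ ⟩
        suc (j + suc (length post))
          ≡⟨ cong suc count ⟩
        suc N ∎
        where
        open ≡-Reasoning
        regroup : ∀ k c r → k + suc (c + suc (r + 1)) ≡ suc (suc k + c + suc r)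
        regroup = solve-∀
      chained′ : Chained w layout
      chained′ = Chained-singles w k u Q R₁ lw (sym hQ)
        (Chained-singles Q c y (suffix t b) rest lQ (trans (cong head X≡) (head-concatP (suffix t b) rest))
          (Chained-cong-last rest (last-suffix t b) b-chained))
      slots-ok : AllFrom Slot 1 layout
      slots-ok = AllFrom-replicate-++ (λ _ → slot-single u) 1 k (Q ∷ R₁)
        (Q-slot , AllFrom-replicate-++ (λ _ → slot-single y) (suc (suc k)) c (suffix t b ∷ rest)
          (subst (λ e → AllFrom Slot (suc e) (suffix t b ∷ rest)) (sym j≡)
            (slot-suffix {suc j} t b b-slot , rest-slots)))
      concat′ : concatP w layout ≡ w ∘ₚ (Q ∘ₚ suffix i P)
      concat′ = trans (concatP-singles w k u (Q ∷ R₁))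
                  (cong (w ∘ₚ_) (trans (concatP-singles Q c y (suffix t b ∷ rest)) (cong (Q ∘ₚ_) (sym X≡))))

    exchange-before : ∀ {bu bv u} → IsShortestExpath G A ℓ Λ bu bv P →
                      ∀ w → IsPath R w → head w ≡ bu → last w ≡ u → ∣ w ∣ₚ ≤ Λ →
                      ∀ Q → IsDecomposable G A ℓ Q → head Q ≡ u → last Q ≡ head (suffix i P) →
                      ∀ k → k < j → k ≤ L → ∣ Q ∣ₚ ≤ 2 ^ k → i ≤ Λ + ∣ Q ∣ₚ
    exchange-before {bv = bv} sh@(_ , _ , lP , _) w pw hw lw ∣w∣≤ Q dQ hQ lQ k k<j k≤L ∣Q∣≤ =
      ≤-trans (+-cancelʳ-≤ ∣ X ∣ₚ i (∣ w ∣ₚ + ∣ Q ∣ₚ) i+∣X∣≤) (+-monoˡ-≤ ∣ Q ∣ₚ ∣w∣≤)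
      where
      X : Path n
      X = suffix i P
      Q-slot : Slot (suc k) Q
      Q-slot = slot-of-block (s≤s (≤-trans k≤L (m≤m+n L (L + 0)))) (block-early k≤L dQ ∣Q∣≤)
      competitor : Slotting 0 (suc N) (w ∘ₚ (Q ∘ₚ X))
      competitor = competitor-before w (pw , ∣w∣≤) lw Q k (j ∸ suc k) (m+[n∸m]≡n k<j) Q-slot hQ lQ
      last-W : last (w ∘ₚ (Q ∘ₚ X)) ≡ bv
      last-W = trans (last-∘ₚ w (Q ∘ₚ X) (trans lw (sym hQ))) (trans (last-∘ₚ Q X lQ) (trans (last-suffix i P) lP))
      i+∣X∣≤ : i + ∣ X ∣ₚ ≤ ∣ w ∣ₚ + ∣ Q ∣ₚ + ∣ X ∣ₚ
      i+∣X∣≤ = begin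
        i + ∣ X ∣ₚ
          ≡⟨ cong (i +_) (∣suffix∣ i P) ⟩
        i + (∣ P ∣ₚ ∸ i)
          ≡⟨ m+[n∸m]≡n (subst (_≤ ∣ P ∣ₚ) (sym offset) (at≤∣P∣ t (<⇒≤ t<∣b∣))) ⟩
        ∣ P ∣ₚ
          ≤⟨ shortest-expath-≤ sh competitor hw last-W ⟩
        ∣ w ∘ₚ (Q ∘ₚ X) ∣ₚ
          ≡⟨ trans (∣∘ₚ∣ w (Q ∘ₚ X)) (trans (cong (∣ w ∣ₚ +_) (∣∘ₚ∣ Q X)) (sym (+-assoc ∣ w ∣ₚ _ _))) ⟩
        ∣ w ∣ₚ + ∣ Q ∣ₚ + ∣ X ∣ₚ ∎
        where open ≤-Reasoning

    after-position : ∀ k c → suc k + c ≡ length post → suc (j + c) + k ≡ 2 * L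
    after-position k c r≡ = suc-injective (trans (regroup j c k) (trans (cong (λ e → j + suc e) r≡) count))
      where
      regroup : ∀ j c k → suc (suc (j + c) + k) ≡ j + suc (suc k + c)
      regroup = solve-∀

    -- Q becomes block 1 + j + c, whose bound 2^(2L - (1 + j + c)) is 2^k by after-position.
    competitor-after : ∀ {v} w → Slot (suc N) w → head w ≡ v →
                       ∀ Q k c → suc k + c ≡ length post → Slot (suc (suc (j + c))) Q →
                       head Q ≡ head (suffix (suc i) P) → last Q ≡ v →
                       Slotting 0 (suc N) (prefix (suc i) P ∘ₚ (Q ∘ₚ w))
    competitor-after {v} w w-slot hw Q k c r≡ Q-slot hQ lQ =
      slotting pa layout count′ chained′ pa-slot slots-ok concat′
      where
      o : ℕ
      o = suc t
      y : Fin n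
      y = head (suffix (suc i) P)
      y≡ : last (prefix o b) ≡ y
      y≡ = trans (last-prefix o b) (sym (trans (cong (λ e → head (suffix e P)) suc-offset) (head-suffix-at o t<∣b∣)))
      V : List (Path n)
      V = replicate k (single v) ++ w ∷ []
      R₂ : List (Path n)
      R₂ = replicate c (single y) ++ Q ∷ V
      layout : List (Path n)
      layout = pre ++ prefix o b ∷ R₂
      count′ : length layout ≡ suc N
      count′ = begin
        length layout
          ≡⟨ List.length-++ pre ⟩
        j + suc (length R₂)
          ≡⟨ cong (λ e → j + suc e) (length-singles c y (Q ∷ V)) ⟩
        j + suc (c + suc (length V))
          ≡⟨ cong (λ e → j + suc (c + suc e)) (length-singles k v (w ∷ [])) ⟩
        j + suc (c + suc (k + 1))
          ≡⟨ regroup j c k ⟩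
        suc (j + suc (suc k + c))
          ≡⟨ cong (λ e → suc (j + suc e)) r≡ ⟩
        suc (j + suc (length post))
          ≡⟨ cong suc count ⟩
        suc N ∎
        where
        open ≡-Reasoning
        regroup : ∀ j c k → j + suc (c + suc (k + 1)) ≡ suc (j + suc (suc k + c))
        regroup = solve-∀
      chained′ : Chained pa layout
      chained′ = Chained-++⁺ pa pre (prefix o b) R₂ pre-chained pre-joint
        (Chained-singles (prefix o b) c y Q V y≡ (sym hQ) (Chained-singles Q k v w [] lQ (sym hw) _))
      slots-ok : AllFrom Slot 1 layout
      slots-ok = AllFrom-++⁺ 1 pre (prefix o b ∷ R₂) pre-slots
        (slot-prefix {suc j} o b b-slot ,
         AllFrom-replicate-++ (λ _ → slot-single y) (suc (suc j)) c (Q ∷ V)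
           (Q-slot , AllFrom-replicate-++ (λ _ → slot-single v) (suc (suc (suc (j + c)))) k (w ∷ [])
             (subst (λ e → Slot (suc (suc e)) w) (sym (after-position k c r≡)) w-slot , _)))
      concat′ : concatP pa layout ≡ prefix (suc i) P ∘ₚ (Q ∘ₚ w)
      concat′ = begin
        concatP pa layout
          ≡⟨ concatP-++ pa pre (prefix o b) R₂ ⟩
        front ∘ₚ concatP (prefix o b) R₂
          ≡⟨ cong (front ∘ₚ_) (concatP-singles (prefix o b) c y (Q ∷ V)) ⟩
        front ∘ₚ (prefix o b ∘ₚ concatP Q V)
          ≡⟨ cong (λ p → front ∘ₚ (prefix o b ∘ₚ p)) (concatP-singles Q k v (w ∷ [])) ⟩
        front ∘ₚ (prefix o b ∘ₚ (Q ∘ₚ w))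
          ≡⟨ sym (∘ₚ-assoc front (prefix o b) (Q ∘ₚ w)) ⟩
        (front ∘ₚ prefix o b) ∘ₚ (Q ∘ₚ w)
          ≡⟨ cong (_∘ₚ (Q ∘ₚ w)) (sym (trans (cong (λ e → prefix e P) suc-offset) (prefix-at o t<∣b∣))) ⟩
        prefix (suc i) P ∘ₚ (Q ∘ₚ w) ∎
        where open ≡-Reasoning

    exchange-after : ∀ {bu bv v} → IsShortestExpath G A ℓ Λ bu bv P →
                     ∀ w → IsPath R w → head w ≡ v → last w ≡ bv → ∣ w ∣ₚ ≤ Λ →
                     ∀ Q → IsDecomposable G A ℓ Q → head Q ≡ head (suffix (suc i) P) → last Q ≡ v →
                     ∀ k → k < length post → k ≤ L → ∣ Q ∣ₚ ≤ 2 ^ k → ∣ P ∣ₚ ∸ suc i ≤ Λ + ∣ Q ∣ₚ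
    exchange-after {bv = bv} sh@(_ , hP , _ , _) w pw hw lw ∣w∣≤ Q dQ hQ lQ k k<r k≤L ∣Q∣≤ =
      ≤-trans (m≤n+o⇒m∸n≤o ∣ P ∣ₚ (suc i) ∣P∣≤) (≤-trans (+-monoʳ-≤ ∣ Q ∣ₚ ∣w∣≤) (≤-reflexive (+-comm ∣ Q ∣ₚ Λ)))
      where
      c : ℕ
      c = length post ∸ suc k
      r≡ : suc k + c ≡ length post
      r≡ = m+[n∸m]≡n k<r
      Y : Path n
      Y = prefix (suc i) P
      Q-slot : Slot (suc (suc (j + c))) Q
      Q-slot = slot-of-block (s≤s (≤-trans (m≤m+n (suc (j + c)) k) (≤-reflexive (after-position k c r≡))))
                 (block-late (after-position k c r≡) k≤L dQ ∣Q∣≤)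
      w-slot : Slot (suc N) w
      w-slot = pw , (λ N<N → ⊥-elim (n≮n N N<N)) , (λ _ → ∣w∣≤)
      competitor : Slotting 0 (suc N) (Y ∘ₚ (Q ∘ₚ w))
      competitor = competitor-after w w-slot hw Q k c r≡ Q-slot hQ lQ
      last-W : last (Y ∘ₚ (Q ∘ₚ w)) ≡ bv
      last-W = trans (last-∘ₚ Y (Q ∘ₚ w) (trans (last-prefix (suc i) P) (sym hQ)))
                     (trans (last-∘ₚ Q w (trans lQ (sym hw))) lw)
      suc-i≤∣P∣ : suc i ≤ ∣ P ∣ₚ
      suc-i≤∣P∣ = subst (_≤ ∣ P ∣ₚ) (sym suc-offset) (at≤∣P∣ (suc t) t<∣b∣)
      ∣P∣≤ : ∣ P ∣ₚ ≤ suc i + (∣ Q ∣ₚ + ∣ w ∣ₚ)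
      ∣P∣≤ = begin
        ∣ P ∣ₚ
          ≤⟨ shortest-expath-≤ sh competitor hP last-W ⟩
        ∣ Y ∘ₚ (Q ∘ₚ w) ∣ₚ
          ≡⟨ trans (∣∘ₚ∣ Y (Q ∘ₚ w)) (cong (∣ Y ∣ₚ +_) (∣∘ₚ∣ Q w)) ⟩
        ∣ Y ∣ₚ + (∣ Q ∣ₚ + ∣ w ∣ₚ)
          ≡⟨ cong (_+ (∣ Q ∣ₚ + ∣ w ∣ₚ)) (∣prefix∣ (suc i) P suc-i≤∣P∣) ⟩
        suc i + (∣ Q ∣ₚ + ∣ w ∣ₚ) ∎
        where open ≤-Reasoning

  bound-before : ∀ {bu bv u P} → IsShortestExpath G A ℓ Λ bu bv P → InBall G A u Λ bu →
                 ∀ i → Λ < i → Λ < ∣ P ∣ₚ ∸ i →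
                 ∀ Q → IsDecomposable G A ℓ Q → head Q ≡ u → last Q ≡ head (suffix i P) → i ≤ 4 * ∣ Q ∣ₚ + Λ
  bound-before {P = P} sh (walk , walk-ok , h-walk , l-walk , ∣walk∣≤) i Λ<i Λ<∣P∣∸i Q dQ hQ lQ
    with reversed-path R-sym walk walk-ok
  ... | w , pw , hw , lw , ∣w∣≤ =
    doubling-bound j Λ<i before-bound (∣decomposable∣≤2^L Q dQ)
      (exchange-before sh w pw (trans hw l-walk) (trans lw h-walk) (≤-trans ∣w∣≤ ∣walk∣≤) Q dQ hQ lQ)
    where open AtLocation (locate (proj₁ sh) i (<⇒≤ Λ<i) (<∸⇒+< ∣ P ∣ₚ i Λ<∣P∣∸i))

  bound-after : ∀ {bu bv v P} → IsShortestExpath G A ℓ Λ bu bv P → InBall G A v Λ bv →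
                ∀ i → Λ < i → Λ < ∣ P ∣ₚ ∸ i →
                ∀ Q → IsDecomposable G A ℓ Q → head Q ≡ head (suffix i P) → last Q ≡ v → ∣ P ∣ₚ ∸ i ≤ 4 * ∣ Q ∣ₚ + Λ
  -- locating i - 1 makes y = P[i] the end of a nonempty prefix of its block
  bound-after {P = P} sh (walk , walk-ok , h-walk , l-walk , ∣walk∣≤) (suc i) Λ<i Λ<∣P∣∸i Q dQ hQ lQ
    with walk⇒path R-sym walk walk-ok
  ... | w , pw , hw , lw , ∣w∣≤ =
    doubling-bound (length post) Λ<∣P∣∸i after-bound (∣decomposable∣≤2^L Q dQ)
      (exchange-after sh w pw (trans hw h-walk) (trans lw l-walk) (≤-trans ∣w∣≤ ∣walk∣≤) Q dQ hQ lQ)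
    where open AtLocation (locate (proj₁ sh) i (≤-pred Λ<i) (<⇒≤ (<∸⇒+< ∣ P ∣ₚ (suc i) Λ<∣P∣∸i)))

lemma6p5 : ∀ {n} (G : Graph n) → UniqueShortestPaths G →
    (Λ : ℕ) (ℬ : Fin n → Set) (u v : Fin n) (A : EdgeSet n) → A ⊆E G →
    (bu bv : Fin n) → ℬ bu → InBall G A u Λ bu → ℬ bv → InBall G A v Λ bv →
    (ℓ : ℕ) → 1 ≤ ℓ →
    (P : Path n) → IsShortestExpath G A ℓ Λ bu bv P →
    (i : Fin (length (toList P))) →
    Λ < toℕ i → Λ < ∣ P ∣ₚ ∸ toℕ i →
    (∀ Q → IsDecomposable G A ℓ Q → head Q ≡ u → last Q ≡ lookup (toList P) i →
       toℕ i ≤ 4 * ∣ Q ∣ₚ + Λ) ×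
    (∀ Q → IsDecomposable G A ℓ Q → head Q ≡ lookup (toList P) i → last Q ≡ v →
       ∣ P ∣ₚ ∸ toℕ i ≤ 4 * ∣ Q ∣ₚ + Λ)
lemma6p5 G _ Λ _ u v A _ bu bv _ ball-u _ ball-v ℓ _ P sh i Λ<i Λ<∣P∣∸i =
  (λ Q dQ hQ lQ → bound-before sh ball-u (toℕ i) Λ<i Λ<∣P∣∸i Q dQ hQ (trans lQ (sym (head-suffix P i)))) ,
  (λ Q dQ hQ lQ → bound-after sh ball-v (toℕ i) Λ<i Λ<∣P∣∸i Q dQ (trans hQ (sym (head-suffix P i))) lQ)
  where open ShortestExpath G A ℓ Λ
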